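{- Let $\mathcal{CS}$ be a constant specification. The canonical AF-model meeting $\mathcal{CS}$ is an AF-model meeting $\mathcal{CS}$.
   Context: Setting: the multi-agent justification logic $\mathsf{LP}_h^{\mathsf{C}}$ for $h$ agents; $i$ ranges over $\{1,\dots,h\}$, $*$ over $\{1,\dots,h,\mathsf{C}\}$, $\circledast$ over $\{1,\dots,h,\mathsf{E},\mathsf{C}\}$. Term sets $\mathrm{Tm}_\circledast$ are built from constants and variables of each type with operations $!_i$ (on $\mathrm{Tm}_i$), $+_*,\cdot_*$ (on $\mathrm{Tm}_*$), tupling $\langle t_1,\dots,t_h\rangle\in\mathrm{Tm}_\mathsf{E}$ for $t_i\in\mathrm{Tm}_i$, projections $\pi_i t\in\mathrm{Tm}_i$ for $t\in\mathrm{Tm}_\mathsf{E}$, two unary co-closure operations $\overline{t},\underline{t}\in\mathrm{Tm}_\mathsf{E}$ for $t\in\mathrm{Tm}_\mathsf{C}$, and induction $\mathrm{ind}(t,s)\in\mathrm{Tm}_\mathsf{C}$ for $t\in\mathrm{Tm}_\mathsf{C}$, $s\in\mathrm{Tm}_\mathsf{E}$. Formulae are built from propositional variables by classical connectives and $t{:}_\circledast A$ with $t\in\mathrm{Tm}_\circledast$. Axioms: propositional tautologies; $t{:}_*(A\to B)\to(s{:}_*A\to (t\cdot s){:}_*B)$; $t{:}_*A\to(t+s){:}_*A$, $s{:}_*A\to(t+s){:}_*A$; $t{:}_iA\to A$; $t{:}_iA\to (!t){:}_i t{:}_iA$; $t_1{:}_1A\wedge\dots\wedge t_h{:}_hA\to\langle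 t_1,\dots,t_h\rangle{:}_\mathsf{E}A$; $t{:}_\mathsf{E}A\to(\pi_it){:}_iA$; $t{:}_\mathsf{C}A\to\overline{t}{:}_\mathsf{E}A$, $t{:}_\mathsf{C}A\to\underline{t}{:}_\mathsf{E}t{:}_\mathsf{C}A$; $A\wedge t{:}_\mathsf{C}(A\to s{:}_\mathsf{E}A)\to\mathrm{ind}(t,s){:}_\mathsf{C}A$. A constant specification $\mathcal{CS}$ is a set of formulae $c{:}_\circledast A$ with $c$ a constant of type $\circledast$ and $A$ an axiom; the system $\mathsf{LP}_h^{\mathsf{C}}(\mathcal{CS})$ has modus ponens and axiom necessitation for members of $\mathcal{CS}$. An AF-model meeting $\mathcal{CS}$ is $(W,R,\mathcal{E},\nu)$ where $W\neq\varnothing$, each $R_i$ is reflexive and transitive on $W$, $\nu$ is a valuation, $R_\mathsf{E}=R_1\cup\dots\cup R_h$, $R_\mathsf{C}=\bigcup_{n\ge1}(R_\mathsf{E})^n$, and the evidence function $\mathcal{E}$ (with $\mathcal{E}_\circledast$ its restriction to $\mathrm{Tm}_\circledast$) satisfies for all $w,v$: monotonicity $\mathcal{E}_*(w,t)\subseteq\mathcal{E}_*(v,t)$ whenever $(w,v)\in R_*$; if $c{:}_\circledast A\in\mathcal{CS}$ then $A\in\mathcal{E}_\circledast(w,c)$; application, sum, inspection closure for $\cdot_*,+_*,!_i$ as in the axioms; tupling: $A\in\mathcal{E}_i(w,t_i)$ for all $i$ implies $A\in\mathcal{E}_\mathsf{E}(w,\langle t_1,\dots,t_h\rangle)$; projection: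 $A\in\mathcal{E}_\mathsf{E}(w,t)$ implies $A\in\mathcal{E}_i(w,\pi_it)$; co-closure: $A\in\mathcal{E}_\mathsf{C}(w,t)$ implies $A\in\mathcal{E}_\mathsf{E}(w,\overline{t})$ and $t{:}_\mathsf{C}A\in\mathcal{E}_\mathsf{E}(w,\underline{t})$; induction: $A\in\mathcal{E}_\mathsf{E}(w,s)$ and $(A\to s{:}_\mathsf{E}A)\in\mathcal{E}_\mathsf{C}(w,t)$ imply $A\in\mathcal{E}_\mathsf{C}(w,\mathrm{ind}(t,s))$. The canonical AF-model meeting $\mathcal{CS}$: $W$ is the set of maximal $\mathcal{CS}$-consistent sets of formulae; $R_i=\{(w,v): w/i\subseteq v\}$ where $w/\circledast=\{A:\ t{:}_\circledast A\in w \text{ for some } t\in\mathrm{Tm}_\circledast\}$; $\mathcal{E}_\circledast(w,t)=\{A: t{:}_\circledast A\in w\}$; $\nu(P)=\{w: P\in w\}$. -}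

module Defs where

open import Level using (Level; _⊔_; 0ℓ) renaming (suc to lsuc)
open import Data.Nat using (ℕ)
open import Data.Fin using (Fin)
open import Data.Bool using (Bool; true; false; _∧_; _∨_; not)
open import Data.List using (List; foldr; map)
open import Data.Fin.Base using () renaming (Fin to F)
open import Data.List.Base using ()
open import Data.Product using (Σ; ∃; _×_; _,_; proj₁)
open import Data.Empty using (⊥)
open import Relation.Nullary using (¬_)
open import Relation.Binary.PropositionalEquality using (_≡_)
open import Relation.Binary.Core using (Rel)
open import Relation.Binary.Definitions using (Reflexive; Transitive)
open import Relation.Binary.Construct.Closure.Transitive using (TransClosure)
open import Data.List using (allFin)

module LP (h : ℕ) where

  -- Types of terms / modalities: agents i, E (everybody), C (common)
  data Ty : Set where
    ag : Fin h → Ty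
    E  : Ty
    C  : Ty

  data Star : Ty → Set where
    agS : (i : Fin h) → Star (ag i)
    CS  : Star C

  data Tm : Ty → Set where
    const : (τ : Ty) → ℕ → Tm τ
    var   : (τ : Ty) → ℕ → Tm τ
    bang  : (i : Fin h) → Tm (ag i) → Tm (ag i)
    plus  : {τ : Ty} → Star τ → Tm τ → Tm τ → Tm τ
    app   : {τ : Ty} → Star τ → Tm τ → Tm τ → Tm τ
    tup   : ((i : Fin h) → Tm (ag i)) → Tm E
    proj  : (i : Fin h) → Tm E → Tm (ag i)
    over  : Tm C → Tm E
    under : Tm C → Tm E
    ind   : Tm C → Tm E → Tm C

  infixr 5 _⇒_
  data Fm : Set where
    patom : ℕ → Fm
    fls   : Fm
    _⇒_   : Fm → Fm → Fm
    jst   : {τ : Ty} → Tm τ → Fm → Fm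

  neg : Fm → Fm
  neg A = A ⇒ fls

  tru : Fm
  tru = neg fls

  and : Fm → Fm → Fm
  and A B = neg (A ⇒ neg B)

  bigAnd : List Fm → Fm
  bigAnd = foldr and tru

  -- Propositional tautologies: true under every Boolean assignment to
  -- the propositional atoms and the justification formulae t :_τ A.
  tval : (Fm → Bool) → Fm → Bool
  tval v (patom p) = v (patom p)
  tval v fls       = false
  tval v (A ⇒ B)   = not (tval v A) ∨ tval v B
  tval v (jst t A) = v (jst t A)

  Tautology : Fm → Set
  Tautology A = (v : Fm → Bool) → tval v A ≡ true

  data Axiom : Fm → Set where
    taut   : ∀ {A} → Tautology A → Axiom A
    appAx  : ∀ {τ} (σ : Star τ) (t s : Tm τ) (A B : Fm) →
             Axiom (jst t (A ⇒ B) ⇒ (jst s A ⇒ jst (app σ t s) B))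
    sumL   : ∀ {τ} (σ : Star τ) (t s : Tm τ) (A : Fm) →
             Axiom (jst t A ⇒ jst (plus σ t s) A)
    sumR   : ∀ {τ} (σ : Star τ) (t s : Tm τ) (A : Fm) →
             Axiom (jst s A ⇒ jst (plus σ t s) A)
    refl   : (i : Fin h) (t : Tm (ag i)) (A : Fm) → Axiom (jst t A ⇒ A)
    insp   : (i : Fin h) (t : Tm (ag i)) (A : Fm) →
             Axiom (jst t A ⇒ jst (bang i t) (jst t A))
    tupAx  : (ts : (i : Fin h) → Tm (ag i)) (A : Fm) →
             Axiom (bigAnd (map (λ i → jst (ts i) A) (allFin h)) ⇒ jst (tup ts) A)
    projAx : (i : Fin h) (t : Tm E) (A : Fm) → Axiom (jst t A ⇒ jst (proj i t) A)
    ccl1   : (t : Tm C) (A : Fm) → Axiom (jst t A ⇒ jst (over t) A)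
    ccl2   : (t : Tm C) (A : Fm) → Axiom (jst t A ⇒ jst (under t) (jst t A))
    indAx  : (t : Tm C) (s : Tm E) (A : Fm) →
             Axiom (and A (jst t (A ⇒ jst s A)) ⇒ jst (ind t s) A)

  IsCS : (Fm → Set) → Set
  IsCS 𝒞 = ∀ F → 𝒞 F →
    Σ Ty λ τ → Σ ℕ λ n → Σ Fm λ A → (F ≡ jst (const τ n) A) × Axiom A

  data Der (𝒞 : Fm → Set) (Γ : Fm → Set) : Fm → Set where
    ax  : ∀ {A} → Axiom A → Der 𝒞 Γ A
    nec : ∀ {F} → 𝒞 F → Der 𝒞 Γ F
    hyp : ∀ {A} → Γ A → Der 𝒞 Γ A
    mp  : ∀ {A B} → Der 𝒞 Γ (A ⇒ B) → Der 𝒞 Γ A → Der 𝒞 Γ B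

  _⊆_ : (Fm → Set) → (Fm → Set) → Set
  Γ ⊆ Δ = ∀ A → Γ A → Δ A

  Consistent : (Fm → Set) → (Fm → Set) → Set
  Consistent 𝒞 Γ = ¬ Der 𝒞 Γ fls

  MaxConsistent : (Fm → Set) → (Fm → Set) → Set₁
  MaxConsistent 𝒞 Γ =
    Consistent 𝒞 Γ × ((Δ : Fm → Set) → Γ ⊆ Δ → Consistent 𝒞 Δ → Δ ⊆ Γ)

  RE : {ℓw ℓr : Level} {W : Set ℓw} → (Fin h → Rel W ℓr) → Rel W ℓr
  RE R w v = Σ (Fin h) λ i → R i w v

  RC : {ℓw ℓr : Level} {W : Set ℓw} → (Fin h → Rel W ℓr) → Rel W (ℓw ⊔ ℓr)
  RC R = TransClosure (RE R)

  Rstar : {ℓw ℓr : Level} {W : Set ℓw} → (Fin h → Rel W ℓr) →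
          {τ : Ty} → Star τ → Rel W (ℓw ⊔ ℓr)
  Rstar {ℓw} R (agS i) w v = Level.Lift ℓw (R i w v)
  Rstar R CS w v = RC R w v

  record IsAFModel {ℓw ℓr ℓe ℓv : Level} (𝒞 : Fm → Set)
      (W : Set ℓw)
      (R : Fin h → Rel W ℓr)
      (𝓔 : W → {τ : Ty} → Tm τ → Fm → Set ℓe)
      (ν : ℕ → W → Set ℓv) : Set (ℓw ⊔ ℓr ⊔ ℓe ⊔ lsuc 0ℓ) where
    field
      nonempty    : W
      R-refl      : (i : Fin h) → Reflexive (R i)
      R-trans     : (i : Fin h) → Transitive (R i)
      monotone    : ∀ {τ} (σ : Star τ) (w v : W) (t : Tm τ) (A : Fm) →
                    Rstar R σ w v → 𝓔 w t A → 𝓔 v t A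
      constSpec   : ∀ (w : W) τ n A → 𝒞 (jst (const τ n) A) → 𝓔 w (const τ n) A
      appCl       : ∀ {τ} (σ : Star τ) (w : W) (t s : Tm τ) (A B : Fm) →
                    𝓔 w t (A ⇒ B) → 𝓔 w s A → 𝓔 w (app σ t s) B
      sumCl       : ∀ {τ} (σ : Star τ) (w : W) (t s : Tm τ) (A : Fm) →
                    (𝓔 w t A → 𝓔 w (plus σ t s) A) × (𝓔 w s A → 𝓔 w (plus σ t s) A)
      inspCl      : ∀ (i : Fin h) (w : W) (t : Tm (ag i)) (A : Fm) →
                    𝓔 w t A → 𝓔 w (bang i t) (jst t A)
      tupCl       : ∀ (w : W) (ts : (i : Fin h) → Tm (ag i)) (A : Fm) →
                    ((i : Fin h) → 𝓔 w (ts i) A) → 𝓔 w (tup ts) A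
      projCl      : ∀ (i : Fin h) (w : W) (t : Tm E) (A : Fm) →
                    𝓔 w t A → 𝓔 w (proj i t) A
      coCl        : ∀ (w : W) (t : Tm C) (A : Fm) → 𝓔 w t A →
                    𝓔 w (over t) A × 𝓔 w (under t) (jst t A)
      indCl       : ∀ (w : W) (t : Tm C) (s : Tm E) (A : Fm) →
                    𝓔 w s A → 𝓔 w t (A ⇒ jst s A) → 𝓔 w (ind t s) A

  module Canonical (𝒞 : Fm → Set) where
    CW : Set₁
    CW = Σ (Fm → Set) (MaxConsistent 𝒞)

    slash : (Fm → Set) → Ty → Fm → Set
    slash w τ A = Σ (Tm τ) λ t → w (jst t A)

    CR : Fin h → Rel CW 0ℓ
    CR i w v = slash (proj₁ w) (ag i) ⊆ proj₁ v

    C𝓔 : CW → {τ : Ty} → Tm τ → Fm → Set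
    C𝓔 w t A = proj₁ w (jst t A)

    Cν : ℕ → CW → Set
    Cν P w = proj₁ w (patom P)

-- Every closure condition on the canonical evidence function is an axiom
-- instance applied inside a deductively closed world, and evidence for
-- t :_C A travels along an R_i-edge because t :_C A yields
-- π_i(under t) :_i (t :_C A).  The real point is that the canonical model is
-- non-empty without Lindenbaum's lemma: forgetting all justifications and
-- making every atom false turns each axiom and each member of CS into a
-- tautology, so the formulae true under this erasure form a consistent set,
-- which is maximal because it contains A or ¬A for every A.

module Submission where

open import Defs
open import Data.Nat using (ℕ; _≤_)
open import Data.Fin using (Fin; fromℕ<)
open import Data.Bool using (Bool; true; false; not; _∨_)
open import Data.Bool.Properties using (∨-inverseˡ; ∨-zeroʳ)
open import Data.List using (_∷_)
open import Data.List.Membership.Propositional using (_∈_)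
open import Data.List.Membership.Propositional.Properties using (∈-map⁺; ∈-allFin)
open import Data.List.Relation.Unary.All using (All; []; _∷_)
open import Data.List.Relation.Unary.All.Properties using (map⁺; tabulate⁺)
open import Data.List.Relation.Unary.Any using (here; there)
open import Data.Empty using (⊥-elim)
open import Data.Product using (_,_; proj₁; proj₂)
open import Function using (_∘_)
open import Data.Sum using (_⊎_; inj₁; inj₂)
open import Level using (lift)
open import Relation.Binary.Definitions using (Reflexive; Transitive)
open import Relation.Binary.PropositionalEquality using (_≡_; refl; sym; trans)
open import Relation.Binary.Construct.Closure.Transitive using ([_]; _∷_)

module CanonicalModel (h : ℕ) (𝒞 : LP.Fm h → Set) where
  open LP h
  open Canonical 𝒞

  private
    variable
      Γ : Fm → Set
      A B D : Fm

  erase : Fm → Bool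
  erase (patom p) = false
  erase fls       = false
  erase (A ⇒ B)   = not (erase A) ∨ erase B
  erase (jst t A) = erase A

  tval-erase : ∀ A → tval erase A ≡ erase A
  tval-erase (patom p) = refl
  tval-erase fls       = refl
  tval-erase (A ⇒ B) rewrite tval-erase A | tval-erase B = refl
  tval-erase (jst t A) = refl

  erase-bigAnd-false : ∀ {l} → B ∈ l → erase B ≡ false → erase (bigAnd l) ≡ false
  erase-bigAnd-false (here refl) B-false rewrite B-false = refl
  erase-bigAnd-false {l = X ∷ l} (there B∈l) B-false
    rewrite erase-bigAnd-false B∈l B-false | ∨-zeroʳ (not (erase X)) = refl

  -- The tupling axiom is the only one whose erasure needs an agent:
  -- for h = 0 it erases to ⊤ → A.
  erase-axiom : Fin h → Axiom A → erase A ≡ true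
  erase-axiom i₀ (taut {A} A-taut) = trans (sym (tval-erase A)) (A-taut erase)
  erase-axiom i₀ (appAx σ t s A B) = ∨-inverseˡ (not (erase A) ∨ erase B)
  erase-axiom i₀ (sumL σ t s A)    = ∨-inverseˡ (erase A)
  erase-axiom i₀ (sumR σ t s A)    = ∨-inverseˡ (erase A)
  erase-axiom i₀ (refl i t A)      = ∨-inverseˡ (erase A)
  erase-axiom i₀ (insp i t A)      = ∨-inverseˡ (erase A)
  erase-axiom i₀ (tupAx ts A) with erase A in A-value
  ... | true  = ∨-zeroʳ _
  ... | false
    rewrite erase-bigAnd-false (∈-map⁺ (λ i → jst (ts i) A) (∈-allFin i₀)) A-value = refl
  erase-axiom i₀ (projAx i t A)    = ∨-inverseˡ (erase A)
  erase-axiom i₀ (ccl1 t A)        = ∨-inverseˡ (erase A)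
  erase-axiom i₀ (ccl2 t A)        = ∨-inverseˡ (erase A)
  erase-axiom i₀ (indAx t s A) with erase A
  ... | true  = refl
  ... | false = refl

  ErasedTrue : Fm → Set
  ErasedTrue A = erase A ≡ true

  erase-mp : erase (A ⇒ B) ≡ true → erase A ≡ true → erase B ≡ true
  erase-mp A⇒B-true A-true rewrite A-true = A⇒B-true

  erase-sound : Fin h → IsCS 𝒞 → Der 𝒞 ErasedTrue A → erase A ≡ true
  erase-sound i₀ cs (ax A-ax) = erase-axiom i₀ A-ax
  erase-sound i₀ cs (nec {F} F∈𝒞) with cs F F∈𝒞
  ... | τ , n , A , refl , A-ax = erase-axiom i₀ A-ax
  erase-sound i₀ cs (hyp A-true) = A-true
  erase-sound i₀ cs (mp {A} {B} d e) =
    erase-mp {A} {B} (erase-sound i₀ cs d) (erase-sound i₀ cs e)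

  erasedTrue-maxConsistent : Fin h → IsCS 𝒞 → MaxConsistent 𝒞 ErasedTrue
  erasedTrue-maxConsistent i₀ cs = consistent , maximal
    where
    consistent : Consistent 𝒞 ErasedTrue
    consistent d with erase-sound i₀ cs d
    ... | ()

    maximal : (Δ : Fm → Set) → ErasedTrue ⊆ Δ → Consistent 𝒞 Δ → Δ ⊆ ErasedTrue
    maximal Δ ⊆Δ Δ-consistent A A∈Δ with erase A in A-value
    ... | true  = refl
    ... | false = ⊥-elim (Δ-consistent (mp (hyp (⊆Δ (neg A) ¬A-true)) (hyp A∈Δ)))
      where
      ¬A-true : erase (neg A) ≡ true
      ¬A-true rewrite A-value = refl

  Der-cut : Der 𝒞 Γ A → Der 𝒞 (λ X → Γ X ⊎ X ≡ A) B → Der 𝒞 Γ B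
  Der-cut d (ax B-ax)          = ax B-ax
  Der-cut d (nec B∈𝒞)          = nec B∈𝒞
  Der-cut d (hyp (inj₁ B∈Γ))   = hyp B∈Γ
  Der-cut d (hyp (inj₂ refl))  = d
  Der-cut d (mp e f)           = mp (Der-cut d e) (Der-cut d f)

  andTaut : ∀ A B → Tautology (A ⇒ B ⇒ and A B)
  andTaut A B v with tval v A | tval v B
  ... | true  | true  = refl
  ... | true  | false = refl
  ... | false | _     = refl

  module MaxConsistentSet (Γ-max : MaxConsistent 𝒞 Γ) where
    Der-closed : Der 𝒞 Γ A → Γ A
    Der-closed {A} d = proj₂ Γ-max (λ X → Γ X ⊎ X ≡ A) (λ _ → inj₁)
      (λ e → proj₁ Γ-max (Der-cut d e)) A (inj₂ refl)

    axiom-mp : Axiom (A ⇒ B) → Γ A → Γ B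
    axiom-mp A⇒B-ax A∈Γ = Der-closed (mp (ax A⇒B-ax) (hyp A∈Γ))

    axiom-mp₂ : Axiom (A ⇒ B ⇒ D) → Γ A → Γ B → Γ D
    axiom-mp₂ A⇒B⇒D-ax A∈Γ B∈Γ = Der-closed (mp (mp (ax A⇒B⇒D-ax) (hyp A∈Γ)) (hyp B∈Γ))

    and-closed : Γ A → Γ B → Γ (and A B)
    and-closed {A} {B} = axiom-mp₂ (taut (andTaut A B))

    bigAnd-closed : ∀ {l} → All Γ l → Γ (bigAnd l)
    bigAnd-closed []            = Der-closed (ax (taut (λ v → refl)))
    bigAnd-closed (A∈Γ ∷ l⊆Γ) = and-closed A∈Γ (bigAnd-closed l⊆Γ)

  open MaxConsistentSet

  private
    variable
      τ : Ty

  C𝓔-mono-CR : ∀ w v {i} {t : Tm (ag i)} → CR i w v → C𝓔 w t A → C𝓔 v t A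
  C𝓔-mono-CR w v {i} {t} wRv t∈w = wRv _ (bang i t , axiom-mp (proj₂ w) (insp i t _) t∈w)

  CR-refl : (i : Fin h) → Reflexive (CR i)
  CR-refl i {w} A (t , t∈w) = axiom-mp (proj₂ w) (refl i t A) t∈w

  CR-trans : (i : Fin h) → Transitive (CR i)
  CR-trans i {w} {v} wRv vRu A (t , t∈w) = vRu A (t , C𝓔-mono-CR w v wRv t∈w)

  C𝓔-mono-RE : ∀ w v {t : Tm C} → RE CR w v → C𝓔 w t A → C𝓔 v t A
  C𝓔-mono-RE w v {t} (i , wRv) t∈w =
    wRv _ (proj i (under t) ,
           axiom-mp (proj₂ w) (projAx i (under t) _) (axiom-mp (proj₂ w) (ccl2 t _) t∈w))

  C𝓔-mono-RC : ∀ w v {t : Tm C} → RC CR w v → C𝓔 w t A → C𝓔 v t A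
  C𝓔-mono-RC w v [ step ]                 = C𝓔-mono-RE w v step
  C𝓔-mono-RC w v (_∷_ {y = u} step steps) = C𝓔-mono-RC u v steps ∘ C𝓔-mono-RE w u step

  C𝓔-mono : (σ : Star τ) → ∀ w v {t : Tm τ} → Rstar CR σ w v → C𝓔 w t A → C𝓔 v t A
  C𝓔-mono (agS i) w v (lift wRv) = C𝓔-mono-CR w v wRv
  C𝓔-mono CS                     = C𝓔-mono-RC

  C𝓔-factive-E : Fin h → ∀ w {s : Tm E} → C𝓔 w s A → proj₁ w A
  C𝓔-factive-E i₀ w {s} s∈w =
    axiom-mp (proj₂ w) (refl i₀ (proj i₀ s) _) (axiom-mp (proj₂ w) (projAx i₀ s _) s∈w)

  canonical-isAFModel : Fin h → IsCS 𝒞 → IsAFModel 𝒞 CW CR C𝓔 Cν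
  canonical-isAFModel i₀ cs = record
    { nonempty  = ErasedTrue , erasedTrue-maxConsistent i₀ cs
    ; R-refl    = CR-refl
    ; R-trans   = CR-trans
    ; monotone  = λ σ w v t A → C𝓔-mono σ w v
    ; constSpec = λ w τ n A c∈𝒞 → Der-closed (proj₂ w) (nec c∈𝒞)
    ; appCl     = λ σ w t s A B → axiom-mp₂ (proj₂ w) (appAx σ t s A B)
    ; sumCl     = λ σ w t s A →
        axiom-mp (proj₂ w) (sumL σ t s A) , axiom-mp (proj₂ w) (sumR σ t s A)
    ; inspCl    = λ i w t A → axiom-mp (proj₂ w) (insp i t A)
    ; tupCl     = λ w ts A ts∈w →
        axiom-mp (proj₂ w) (tupAx ts A) (bigAnd-closed (proj₂ w) (map⁺ (tabulate⁺ ts∈w)))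
    ; projCl    = λ i w t A → axiom-mp (proj₂ w) (projAx i t A)
    ; coCl      = λ w t A t∈w →
        axiom-mp (proj₂ w) (ccl1 t A) t∈w , axiom-mp (proj₂ w) (ccl2 t A) t∈w
    ; indCl     = λ w t s A s∈w t∈w →
        axiom-mp (proj₂ w) (indAx t s A) (and-closed (proj₂ w) (C𝓔-factive-E i₀ w s∈w) t∈w)
    }

lemma9 : (h : ℕ) → 1 ≤ h → (𝒞 : LP.Fm h → Set) → LP.IsCS h 𝒞 →
    LP.IsAFModel h 𝒞 (LP.Canonical.CW h 𝒞) (LP.Canonical.CR h 𝒞)
      (LP.Canonical.C𝓔 h 𝒞) (LP.Canonical.Cν h 𝒞)
lemma9 h 1≤h 𝒞 = CanonicalModel.canonical-isAFModel h 𝒞 (fromℕ< 1≤h)
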